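{- Let $X$ be a bounded lattice and $\mu:X\to[0,1]$ a density. Then (1) $\mu$ is subadditive if and only if $\partial^2\mu\equiv0$, if and only if $\partial^n\mu\equiv 0$ for every $n\ge2$; (2) if $\mu\ge\nu$ for some submeasure $\nu:X\to[0,1]$, then $\partial^n\mu(\mathbf 1)=0$ for all $n\in\mathbb N$.
   Context: A lattice is a set $X$ with commutative, associative, idempotent operations $\vee,\wedge$ satisfying the absorption laws, ordered by $x\le y$ iff $x\wedge y=x$; bounded means there are least and greatest elements $\mathbf 0\ne\mathbf 1$. A density on $X$ is a monotone function $\mu:X\to[0,1]$ with $\mu(\mathbf 0)=0$, $\mu(\mathbf 1)=1$; it is subadditive if $\mu(a\vee b)\le\mu(a)+\mu(b)$ for all $a,b$; a submeasure is a subadditive density. For $x\in X$ and $n\in\mathbb N$, $x/n=\{A\subset X:|A|\le n,\ \bigvee A=x\}$ (finite joins), and $\partial^n\mu(x)=\sup_{A\in x/n}\big(\mu(x)-\sum_{a\in A}\mu(a)\big)$. -}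

module Defs where

open import Level using (Level; _⊔_) renaming (suc to lsuc; zero to lzero)
open import Data.Nat using (ℕ) renaming (_≤_ to _≤ℕ_)
open import Data.List using (List; []; _∷_; foldr; length)
open import Data.Product using (Σ; ∃; _×_; _,_)
open import Relation.Nullary using (¬_)
open import Relation.Binary.PropositionalEquality using (_≡_; _≢_)
open import Relation.Binary.Structures using (IsTotalOrder)
open import Algebra.Structures using (IsCommutativeRing)
open import Algebra.Lattice.Bundles using (Lattice)
import Data.List.Relation.Unary.Unique.Setoid as UniqueS

record RealField : Set₁ where
  infixl 6 _+_ _-_
  infixl 7 _*_
  infix 4 _≤_
  field
    ℝ     : Set
    0r 1r : ℝ
    _+_ _*_ : ℝ → ℝ → ℝ
    -_    : ℝ → ℝ
    _≤_   : ℝ → ℝ → Set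
    isCommutativeRing : IsCommutativeRing _≡_ _+_ _*_ -_ 0r 1r
    0≢1   : 0r ≢ 1r
    inverse : ∀ x → x ≢ 0r → ∃ λ y → x * y ≡ 1r
    isTotalOrder : IsTotalOrder _≡_ _≤_
    +-mono : ∀ {x y} z → x ≤ y → x + z ≤ y + z
    *-nonneg : ∀ {x y} → 0r ≤ x → 0r ≤ y → 0r ≤ x * y

  _-_ : ℝ → ℝ → ℝ
  x - y = x + (- y)

  UpperBound : {p : Level} → (ℝ → Set p) → ℝ → Set p
  UpperBound S u = ∀ r → S r → r ≤ u

  IsSup : {p : Level} → (ℝ → Set p) → ℝ → Set p
  IsSup S s = UpperBound S s × (∀ u → UpperBound S u → s ≤ u)

  field
    complete : (S : ℝ → Set) → (∃ λ r → S r) → (∃ λ u → UpperBound S u) →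
               ∃ λ s → IsSup S s

record BoundedLattice (c ℓ : Level) : Set (lsuc (c ⊔ ℓ)) where
  field
    lattice : Lattice c ℓ
  open Lattice lattice public
  field
    𝟎 𝟏 : Carrier
    𝟎-least    : ∀ x → 𝟎 ∧ x ≈ 𝟎
    𝟏-greatest : ∀ x → x ∧ 𝟏 ≈ x
    𝟎≉𝟏        : ¬ (𝟎 ≈ 𝟏)

  _≤L_ : Carrier → Carrier → Set ℓ
  x ≤L y = x ∧ y ≈ x

  ⋁ : List Carrier → Carrier
  ⋁ = foldr _∨_ 𝟎

  -- lists without repetitions represent finite subsets
  Unique : List Carrier → Set (c ⊔ ℓ)
  Unique = UniqueS.Unique setoid

module _ (R : RealField) (X : BoundedLattice lzero lzero) where
  open RealField R
  open BoundedLattice X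

  IsDensity : (Carrier → ℝ) → Set
  IsDensity μ = (∀ x → 0r ≤ μ x × μ x ≤ 1r)
              × (∀ x y → x ≤L y → μ x ≤ μ y)
              × (μ 𝟎 ≡ 0r) × (μ 𝟏 ≡ 1r)

  Subadditive : (Carrier → ℝ) → Set
  Subadditive μ = ∀ a b → μ (a ∨ b) ≤ μ a + μ b

  IsSubmeasure : (Carrier → ℝ) → Set
  IsSubmeasure μ = IsDensity μ × Subadditive μ

  sumμ : (Carrier → ℝ) → List Carrier → ℝ
  sumμ μ = foldr (λ a s → μ a + s) 0r

  _∈_/_ : List Carrier → Carrier → ℕ → Set
  A ∈ x / n = Unique A × (length A ≤ℕ n) × (⋁ A ≈ x)

  DefectSet : (Carrier → ℝ) → ℕ → Carrier → ℝ → Set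
  DefectSet μ n x r = Σ (List Carrier) λ A → (A ∈ x / n) × (r ≡ μ x - sumμ μ A)

  ∂[_]_at_≡_ : ℕ → (Carrier → ℝ) → Carrier → ℝ → Set
  ∂[ n ] μ at x ≡ d = IsSup (λ r → DefectSet μ n x r) d

module Submission where

-- For n ≥ 1 the singleton {x} has defect 0, so ∂ⁿμ(x) = 0 exactly
-- when μ(x) ≤ Σ_{a∈A} μ(a) for all A ∈ x/n.  Subadditivity extends by
-- induction to finite joins, giving ∂ⁿμ ≡ 0 for every n ≥ 1; if ν ≤ μ is a
-- submeasure then μ(𝟏) = ν(𝟏) = ν(⋁A) ≤ Σ ν(a) ≤ Σ μ(a).  Conversely
-- ∂²μ(a ∨ b) = 0 applied to A = {a, b} gives μ(a ∨ b) ≤ μ(a) + μ(b) when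
-- a ≉ b (A must be a set), and the inequality is immediate when a ≈ b.  As
-- lattice equality is undecidable this split only holds under ¬¬, which is
-- removed since ≤ on a complete ordered field is ¬¬-stable (an Archimedean
-- argument).

open import Defs
open import Level using (0ℓ)
open import Data.Nat using (ℕ; suc; s≤s; z≤n) renaming (_≤_ to _≤ℕ_)
open import Data.Nat.Properties using () renaming (≤-refl to ≤ℕ-refl; ≤-trans to ≤ℕ-trans)
open import Data.Product using (_×_; _,_; proj₁; proj₂; Σ)
open import Data.Sum using (inj₁; inj₂)
open import Data.Empty using (⊥-elim)
open import Data.List using ([]; _∷_)
open import Data.List.Relation.Unary.All using ([]; _∷_)
open import Data.List.Relation.Unary.AllPairs using ([]; _∷_)
open import Function.Bundles using (_⇔_; mk⇔)
open import Relation.Nullary using (¬_)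
open import Relation.Binary.PropositionalEquality as P using (_≡_; refl)
open import Relation.Binary.Structures using (IsTotalOrder)
open import Algebra.Bundles using (CommutativeRing)
import Algebra.Lattice.Properties.Lattice as LatticeProperties

module OrderedField (R : RealField) where
  open RealField R

  ring : CommutativeRing 0ℓ 0ℓ
  ring = record { isCommutativeRing = isCommutativeRing }

  open CommutativeRing ring public using (+-identityʳ; -‿inverseʳ)
  open CommutativeRing ring using (+-comm; +-identityˡ; +-abelianGroup; +-rawMonoid)
  open import Algebra.Properties.AbelianGroup +-abelianGroup using (//-rightDividesˡ; xyx⁻¹≈y; ⁻¹-involutive)
  open import Algebra.Properties.Ring (CommutativeRing.ring ring) using (-1*x≈-x)
  open import Algebra.Definitions.RawMonoid +-rawMonoid using () renaming (_×_ to _·_)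
  open IsTotalOrder isTotalOrder public using (total; antisym; trans) renaming (refl to ≤-refl)

  ≤-subst : ∀ {x y z w} → x ≡ y → z ≡ w → x ≤ z → y ≤ w
  ≤-subst = P.subst₂ _≤_

  +-mono₂ : ∀ {a b c d} → a ≤ b → c ≤ d → a + c ≤ b + d
  +-mono₂ {a} {b} {c} {d} a≤b c≤d =
    trans (+-mono c a≤b) (≤-subst (+-comm c b) (+-comm d b) (+-mono b c≤d))

  x≤x+y : ∀ {x y} → 0r ≤ y → x ≤ x + y
  x≤x+y {x} {y} 0≤y = ≤-subst (+-identityˡ x) (+-comm y x) (+-mono x 0≤y)

  x≤y⇒x-y≤0 : ∀ {x y} → x ≤ y → x - y ≤ 0r
  x≤y⇒x-y≤0 {x} {y} x≤y = ≤-subst refl (-‿inverseʳ y) (+-mono (- y) x≤y)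

  x-y≤0⇒x≤y : ∀ {x y} → x - y ≤ 0r → x ≤ y
  x-y≤0⇒x≤y {x} {y} h = ≤-subst (//-rightDividesˡ y x) (+-identityˡ y) (+-mono y h)

  s+x≤s⇒x≤0 : ∀ {s x} → s + x ≤ s → x ≤ 0r
  s+x≤s⇒x≤0 {s} {x} h = ≤-subst (xyx⁻¹≈y s x) (-‿inverseʳ s) (+-mono (- s) h)

  -- An ordered field is nontrivially ordered: 1 ≤ 0 would give 0 ≤ (-1)(-1) = 1.
  1≰0 : ¬ (1r ≤ 0r)
  1≰0 1≤0 = 0≢1 (antisym (≤-subst refl neg1²≡1 (*-nonneg 0≤-1 0≤-1)) 1≤0)
    where
    0≤-1 : 0r ≤ - 1r
    0≤-1 = ≤-subst (-‿inverseʳ 1r) (+-identityˡ (- 1r)) (+-mono (- 1r) 1≤0)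
    neg1²≡1 : (- 1r) * (- 1r) ≡ 1r
    neg1²≡1 = P.trans (-1*x≈-x (- 1r)) (⁻¹-involutive 1r)

  ·-nonpositive : ∀ n {x} → x ≤ 0r → n · x ≤ 0r
  ·-nonpositive 0       x≤0 = ≤-refl
  ·-nonpositive (suc n) x≤0 = ≤-subst refl (+-identityˡ 0r) (+-mono₂ x≤0 (·-nonpositive n x≤0))

  -- Archimedean argument: if ¬¬ (x ≤ 0) the multiples of x are bounded by 1,
  -- so they have a supremum s; then s - x is also an upper bound, whence x ≤ 0.
  nonpositive-stable : ∀ x → ¬ ¬ (x ≤ 0r) → x ≤ 0r
  nonpositive-stable x ¬¬x≤0 = s+x≤s⇒x≤0 s+x≤s
    where
    Multiple : ℝ → Set
    Multiple r = Σ ℕ λ n → r ≡ n · x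

    multiples≤1 : UpperBound Multiple 1r
    multiples≤1 _ (n , refl) with total (n · x) 1r
    ... | inj₁ nx≤1 = nx≤1
    ... | inj₂ 1≤nx = ⊥-elim (¬¬x≤0 λ x≤0 → 1≰0 (trans 1≤nx (·-nonpositive n x≤0)))

    supremum = complete Multiple (0r , 0 , refl) (1r , multiples≤1)
    s = proj₁ supremum

    s-x-bound : UpperBound Multiple (s - x)
    s-x-bound _ (n , refl) =
      ≤-subst (xyx⁻¹≈y x (n · x)) refl (+-mono (- x) (proj₁ (proj₂ supremum) _ (suc n , refl)))

    s+x≤s : s + x ≤ s
    s+x≤s = ≤-subst refl (//-rightDividesˡ x s) (+-mono x (proj₂ (proj₂ supremum) (s - x) s-x-bound))

  ≤-stable : ∀ {x y} → ¬ ¬ (x ≤ y) → x ≤ y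
  ≤-stable {x} {y} ¬¬x≤y =
    x-y≤0⇒x≤y (nonpositive-stable (x - y) λ k → ¬¬x≤y λ x≤y → k (x≤y⇒x-y≤0 x≤y))

module Defects (R : RealField) (X : BoundedLattice 0ℓ 0ℓ) where
  open RealField R
  open OrderedField R
  open BoundedLattice X using (Carrier; _∨_; _≈_; 𝟎; 𝟏; ⋁; lattice; ∧-comm; ∨-absorbs-∧; ∨-congˡ; ∧-congˡ; 𝟎-least)
    renaming (sym to ≈-sym; trans to ≈-trans)
  open LatticeProperties lattice using (∧-idem; ∨-idem)

  ∨-identityʳ : ∀ a → a ∨ 𝟎 ≈ a
  ∨-identityʳ a = ≈-trans (∨-congˡ (≈-sym (≈-trans (∧-comm a 𝟎) (𝟎-least a)))) (∨-absorbs-∧ a 𝟎)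

  Monotone : (Carrier → ℝ) → Set
  Monotone μ = ∀ x y → BoundedLattice._≤L_ X x y → μ x ≤ μ y

  monotone-resp-≈ : ∀ {μ} → Monotone μ → ∀ {x y} → x ≈ y → μ x ≡ μ y
  monotone-resp-≈ mono {x} {y} x≈y =
    antisym (mono x y (≈-trans (∧-congˡ (≈-sym x≈y)) (∧-idem x)))
            (mono y x (≈-trans (∧-congˡ x≈y) (∧-idem y)))

  -- Subadditivity extends to finite joins (the empty join 𝟎 needs μ 𝟎 = 0).
  subadditive-⋁ : ∀ {μ} → μ 𝟎 ≡ 0r → Subadditive R X μ → ∀ A → μ (⋁ A) ≤ sumμ R X μ A
  subadditive-⋁ μ𝟎≡0 sub []      = ≤-subst (P.sym μ𝟎≡0) refl ≤-refl
  subadditive-⋁ μ𝟎≡0 sub (a ∷ A) = trans (sub a (⋁ A)) (+-mono₂ ≤-refl (subadditive-⋁ μ𝟎≡0 sub A))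

  sumμ-mono : ∀ {μ ν} → (∀ x → ν x ≤ μ x) → ∀ A → sumμ R X ν A ≤ sumμ R X μ A
  sumμ-mono ν≤μ []      = ≤-refl
  sumμ-mono ν≤μ (a ∷ A) = +-mono₂ (ν≤μ a) (sumμ-mono ν≤μ A)

  NoPositiveDefect : (Carrier → ℝ) → ℕ → Carrier → Set
  NoPositiveDefect μ n x = ∀ A → _∈_/_ R X A x n → μ x ≤ sumμ R X μ A

  singleton-defect : ∀ μ {n} x → 1 ≤ℕ n → DefectSet R X μ n x 0r
  singleton-defect μ x (s≤s _) =
    (x ∷ []) , (([] ∷ []) , s≤s z≤n , ∨-identityʳ x) , P.sym defect≡0
    where
    defect≡0 : μ x - (μ x + 0r) ≡ 0r
    defect≡0 = P.trans (P.cong (λ t → μ x - t) (+-identityʳ (μ x))) (-‿inverseʳ (μ x))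

  no-positive-defect⇒∂≡0 : ∀ {μ n x} → 1 ≤ℕ n → NoPositiveDefect μ n x → ∂[_]_at_≡_ R X n μ x 0r
  no-positive-defect⇒∂≡0 {μ} {x = x} 1≤n noDefect =
    (λ { _ (A , A∈x/n , refl) → x≤y⇒x-y≤0 (noDefect A A∈x/n) })
    , λ _ bound → bound 0r (singleton-defect μ x 1≤n)

  ∂≡0⇒no-positive-defect : ∀ {μ n x} → ∂[_]_at_≡_ R X n μ x 0r → NoPositiveDefect μ n x
  ∂≡0⇒no-positive-defect (bound , _) A A∈x/n = x-y≤0⇒x≤y (bound _ (A , A∈x/n , refl))

  subadditive⇒∂≡0 : ∀ {μ} → IsDensity R X μ → Subadditive R X μ
                  → ∀ n → 1 ≤ℕ n → ∀ x → ∂[_]_at_≡_ R X n μ x 0r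
  subadditive⇒∂≡0 (_ , mono , μ𝟎≡0 , _) sub n 1≤n x =
    no-positive-defect⇒∂≡0 1≤n λ A (_ , _ , ⋁A≈x) →
      ≤-subst (monotone-resp-≈ mono ⋁A≈x) refl (subadditive-⋁ μ𝟎≡0 sub A)

  ∂²≡0⇒subadditive : ∀ {μ} → IsDensity R X μ → (∀ x → ∂[_]_at_≡_ R X 2 μ x 0r) → Subadditive R X μ
  ∂²≡0⇒subadditive {μ} (bounds , mono , _ , _) ∂²≡0 a b =
    ≤-stable λ ≰ → ≰ (distinct-case λ a≈b → ≰ (equal-case a≈b))
    where
    equal-case : a ≈ b → μ (a ∨ b) ≤ μ a + μ b
    equal-case a≈b =
      ≤-subst (P.sym (monotone-resp-≈ mono (≈-trans (∨-congˡ (≈-sym a≈b)) (∨-idem a)))) refl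
              (x≤x+y (proj₁ (bounds b)))

    distinct-case : ¬ (a ≈ b) → μ (a ∨ b) ≤ μ a + μ b
    distinct-case a≉b =
      ≤-subst refl (P.cong (μ a +_) (+-identityʳ (μ b)))
              (∂≡0⇒no-positive-defect (∂²≡0 (a ∨ b)) (a ∷ b ∷ []) ab∈[a∨b]/2)
      where
      ab∈[a∨b]/2 : _∈_/_ R X (a ∷ b ∷ []) (a ∨ b) 2
      ab∈[a∨b]/2 = ((a≉b ∷ []) ∷ [] ∷ []) , s≤s (s≤s z≤n) , ∨-congˡ (∨-identityʳ b)

  dominates-submeasure⇒∂𝟏≡0 : ∀ {μ} → IsDensity R X μ → (ν : Carrier → ℝ) → IsSubmeasure R X ν
                            → (∀ x → ν x ≤ μ x) → ∀ n → 1 ≤ℕ n → ∂[_]_at_≡_ R X n μ 𝟏 0r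
  dominates-submeasure⇒∂𝟏≡0 (_ , _ , _ , μ𝟏≡1) ν ((_ , monoν , ν𝟎≡0 , ν𝟏≡1) , subν) ν≤μ n 1≤n =
    no-positive-defect⇒∂≡0 1≤n λ A (_ , _ , ⋁A≈𝟏) →
      ≤-subst (P.trans (monotone-resp-≈ monoν ⋁A≈𝟏) (P.trans ν𝟏≡1 (P.sym μ𝟏≡1))) refl
              (trans (subadditive-⋁ ν𝟎≡0 subν A) (sumμ-mono ν≤μ A))

proposition1p4 : (R : RealField) (X : BoundedLattice 0ℓ 0ℓ)
    → let open RealField R in let open BoundedLattice X in
      (μ : Carrier → ℝ) → IsDensity R X μ
    → ((Subadditive R X μ ⇔ (∀ x → ∂[_]_at_≡_ R X 2 μ x 0r))
       × ((∀ x → ∂[_]_at_≡_ R X 2 μ x 0r)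
          ⇔ (∀ n → 2 ≤ℕ n → ∀ x → ∂[_]_at_≡_ R X n μ x 0r)))
      × ((ν : Carrier → ℝ) → IsSubmeasure R X ν → (∀ x → ν x ≤ μ x)
         → ∀ n → 1 ≤ℕ n → ∂[_]_at_≡_ R X n μ 𝟏 0r)
proposition1p4 R X μ density =
  ( mk⇔ (λ sub → subadditive⇒∂≡0 density sub 2 1≤2)
        (∂²≡0⇒subadditive density)
  , mk⇔ (λ ∂²≡0 n 2≤n → subadditive⇒∂≡0 density (∂²≡0⇒subadditive density ∂²≡0) n (≤ℕ-trans 1≤2 2≤n))
        (λ ∂ⁿ≡0 → ∂ⁿ≡0 2 ≤ℕ-refl) )
  , dominates-submeasure⇒∂𝟏≡0 density
  where
  open Defects R X
  1≤2 : 1 ≤ℕ 2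
  1≤2 = s≤s z≤n
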